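{- Let $k\ge0$, let $\alpha$ be a state of the infinite state graph $G_\infty$, and let $\beta=\mathrm{FR}(\alpha)$. Let $A$ be the set of all walks of length $k$ in $G_\infty$ that pass through $\alpha$, and $B$ the set of all walks of length $k$ in $G_\infty$ that pass through $\beta$. Then there exists a bijection between $A$ and $B$.
   Context: Vertices of $G_\infty$ (states) are bi-infinite $0/1$ sequences $(x_i)_{i\in\mathbb{Z}}$ with $x_i=1$ for all sufficiently small $i$ and $x_i=0$ for all sufficiently large $i$, considered up to translation of indices. There is a transition $\gamma\to\delta$ iff $\delta$ is obtained from $\gamma$ by changing exactly one entry $0$ into $1$ (up to translation). A walk of length $k$ is a sequence of states $\gamma_0\to\gamma_1\to\cdots\to\gamma_k$ in which each consecutive pair is a transition; it passes through $\alpha$ if $\gamma_i=\alpha$ for some $i$. The flip-reverse map $\mathrm{FR}$ sends a state $(x_i)_{i\in\mathbb{Z}}$ to $(1-x_{ -i})_{i\in\mathbb{Z}}$ (complement every digit, then reverse the order). -}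

module Defs where

open import Data.Bool using (Bool; true; false; not)
open import Data.Integer using (ℤ; _+_; -_; _≤_; _≥_; 0ℤ)
open import Data.Integer.Properties
  using (+-identityʳ; +-assoc; +-inverseˡ; neg-mono-≤; neg-involutive)
open import Data.Nat using (ℕ; suc)
open import Data.Fin using (Fin; inject₁) renaming (suc to fsuc)
open import Data.Product using (Σ; ∃; ∃-syntax; _×_; _,_; proj₁; proj₂)
open import Relation.Binary.PropositionalEquality
open import Relation.Binary.Bundles using (Setoid)
open import Relation.Binary.Structures using (IsEquivalence)
open import Relation.Nullary using (¬_)
open import Level using (0ℓ)

-- A state representative: a bi-infinite 0/1 sequence (true = 1, false = 0)
-- that is 1 for all sufficiently small indices and 0 for all sufficiently
-- large indices.
record Seq : Set where
  field
    seq   : ℤ → Bool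
    left  : ∃[ N ] (∀ i → i ≤ N → seq i ≡ true)
    right : ∃[ M ] (∀ i → i ≥ M → seq i ≡ false)
open Seq public

-- States are sequences up to translation of indices: x ≈ y iff y is x shifted.
_≈ₛ_ : Seq → Seq → Set
x ≈ₛ y = ∃[ t ] (∀ i → seq x (i + t) ≡ seq y i)

≈ₛ-refl : ∀ {x} → x ≈ₛ x
≈ₛ-refl {x} = 0ℤ , λ i → cong (seq x) (+-identityʳ i)

≈ₛ-sym : ∀ {x y} → x ≈ₛ y → y ≈ₛ x
≈ₛ-sym {x} {y} (t , p) = - t , λ i →
  trans (sym (p (i + - t)))
        (cong (seq x) (trans (+-assoc i (- t) t)
                      (trans (cong (i +_) (+-inverseˡ t)) (+-identityʳ i))))

≈ₛ-trans : ∀ {x y z} → x ≈ₛ y → y ≈ₛ z → x ≈ₛ z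
≈ₛ-trans {x} {y} {z} (t , p) (s , q) = s + t , λ i →
  trans (cong (seq x) (sym (+-assoc i s t))) (trans (p (i + s)) (q i))

StateSetoid : Setoid 0ℓ 0ℓ
StateSetoid = record
  { Carrier = Seq
  ; _≈_ = _≈ₛ_
  ; isEquivalence = record { refl = λ {x} → ≈ₛ-refl {x} ; sym = λ {x} {y} → ≈ₛ-sym {x} {y} ; trans = λ {x} {y} {z} → ≈ₛ-trans {x} {y} {z} }
  }

Trans : Seq → Seq → Set
Trans γ δ = ∃[ t ] ∃[ j ]
  ( seq γ j ≡ false
  × seq δ (j + t) ≡ true
  × (∀ i → ¬ (i ≡ j) → seq γ i ≡ seq δ (i + t)) )

record Walk (k : ℕ) : Set where
  field
    state : Fin (suc k) → Seq
    steps : ∀ (i : Fin k) → Trans (state (inject₁ i)) (state (fsuc i))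
open Walk public

PassesThrough : ∀ {k} → Walk k → Seq → Set
PassesThrough w α = ∃[ i ] (state w i ≈ₛ α)

FR : Seq → Seq
FR x = record
  { seq = λ i → not (seq x (- i))
  ; left = - proj₁ (right x) , λ i i≤ →
      cong not (proj₂ (right x) (- i)
        (subst (_≤ - i) (neg-involutive (proj₁ (right x))) (neg-mono-≤ i≤)))
  ; right = - proj₁ (left x) , λ i i≥ →
      cong not (proj₂ (left x) (- i)
        (subst (- i ≤_) (neg-involutive (proj₁ (left x))) (neg-mono-≤ i≥)))
  }

WalksThrough : ℕ → Seq → Setoid 0ℓ 0ℓ
WalksThrough k α = record
  { Carrier = Σ (Walk k) (λ w → PassesThrough w α)
  ; _≈_ = λ w v → ∀ i → state (proj₁ w) i ≈ₛ state (proj₁ v) i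
  ; isEquivalence = record
      { refl = λ {w} i → ≈ₛ-refl {state (proj₁ w) i}
      ; sym = λ {w} {v} p i → ≈ₛ-sym {state (proj₁ w) i} {state (proj₁ v) i} (p i)
      ; trans = λ {w} {v} {u} p q i →
          ≈ₛ-trans {state (proj₁ w) i} {state (proj₁ v) i} {state (proj₁ u) i} (p i) (q i)
      }
  }

{-# OPTIONS --safe #-}
module Submission where

open import Defs
open import Data.Nat using (ℕ)
open import Function.Bundles using (Bijection; Inverse)
open import Function.Properties.Inverse using (Inverse⇒Bijection)
open import Data.Bool using (not)
open import Data.Bool.Properties using (not-involutive)
open import Data.Integer using (_+_; -_; 0ℤ)
open import Data.Integer.Properties using (+-identityʳ; neg-involutive)
open import Data.Integer.Tactic.RingSolver using (solve-∀)
open import Data.Fin using (Fin; inject₁; opposite) renaming (suc to fsuc; zero to fzero)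
open import Data.Fin.Properties using (opposite-involutive)
open import Data.Product using (_,_; proj₁)
open import Relation.Binary.PropositionalEquality
open import Relation.Binary.Bundles using (Setoid)
open import Function using (_∘′_)

-- FR respects translation, is an involution, and turns a transition γ → δ
-- into a transition FR δ → FR γ.  So applying FR to every state of a walk
-- and reading the walk backwards gives a walk of the same length; this
-- operation is its own inverse and sends walks through α to walks through FR α.

neg-+-cancelʳ : ∀ i t → - (i + t) + t ≡ - i
neg-+-cancelʳ = solve-∀

neg-+-neg : ∀ i t → - (i + - t) ≡ - i + t
neg-+-neg = solve-∀

neg-neg-+-cancelʳ : ∀ j t → - (- (j + t) + t) ≡ j
neg-neg-+-cancelʳ = solve-∀

FR-cong : ∀ {x y} → x ≈ₛ y → FR x ≈ₛ FR y
FR-cong {x} (t , x≈y) = - t , λ i →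
  cong not (trans (cong (seq x) (neg-+-neg i t)) (x≈y (- i)))

FR-involutive : ∀ x → FR (FR x) ≈ₛ x
FR-involutive x = 0ℤ , λ i →
  trans (not-involutive _) (cong (seq x) (trans (neg-involutive (i + 0ℤ)) (+-identityʳ i)))

FR-Trans : ∀ {γ δ} → Trans γ δ → Trans (FR δ) (FR γ)
FR-Trans {γ} {δ} (t , j , γj≡0 , δj≡1 , γ≡δ) =
  t , - (j + t) ,
  trans (cong (λ m → not (seq δ m)) (neg-involutive (j + t))) (cong not δj≡1) ,
  trans (cong (λ m → not (seq γ m)) (neg-neg-+-cancelʳ j t)) (cong not γj≡0) ,
  λ i i≢j′ → cong not (sym (trans (γ≡δ (- (i + t)) (i≢j′ ∘′ reflect i))
                                  (cong (seq δ) (neg-+-cancelʳ i t))))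
  where
  reflect : ∀ i → - (i + t) ≡ j → i ≡ - (j + t)
  reflect i e = trans (sym (neg-neg-+-cancelʳ i t)) (cong (λ m → - (m + t)) e)

opposite-inject₁ : ∀ {k} (i : Fin k) → opposite (inject₁ i) ≡ fsuc (opposite i)
opposite-inject₁ fzero    = refl
opposite-inject₁ (fsuc i) = cong inject₁ (opposite-inject₁ i)

FR-walk : ∀ {k} → Walk k → Walk k
state (FR-walk w) j = FR (state w (opposite j))
steps (FR-walk w) i rewrite opposite-inject₁ i =
  FR-Trans {state w (inject₁ (opposite i))} {state w (fsuc (opposite i))} (steps w (opposite i))

_≈ʷ_ : ∀ {k} → Walk k → Walk k → Set
w ≈ʷ v = ∀ i → state w i ≈ₛ state v i

FR-walk-cong : ∀ {k} {w v : Walk k} → w ≈ʷ v → FR-walk w ≈ʷ FR-walk v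
FR-walk-cong {w = w} {v} w≈v j =
  FR-cong {state w (opposite j)} {state v (opposite j)} (w≈v (opposite j))

FR-walk-involutive : ∀ {k} (w : Walk k) → FR-walk (FR-walk w) ≈ʷ w
FR-walk-involutive w i rewrite opposite-involutive i = FR-involutive (state w i)

FR-walk-swap : ∀ {k} {w v : Walk k} → w ≈ʷ FR-walk v → FR-walk w ≈ʷ v
FR-walk-swap {w = w} {v} w≈v i =
  ≈ₛ-trans {state (FR-walk w) i} {state (FR-walk (FR-walk v)) i} {state v i}
    (FR-walk-cong {w = w} {FR-walk v} w≈v i) (FR-walk-involutive v i)

PassesThrough-resp : ∀ {k} {w : Walk k} {α β} →
                     α ≈ₛ β → PassesThrough w α → PassesThrough w β
PassesThrough-resp {w = w} {α} {β} α≈β (i , p) = i , ≈ₛ-trans {state w i} {α} {β} p α≈β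

FR-walk-passesThrough : ∀ {k} {w : Walk k} {α} →
                        PassesThrough w α → PassesThrough (FR-walk w) (FR α)
FR-walk-passesThrough {w = w} {α} (i , p) =
  opposite i , subst (λ j → FR (state w j) ≈ₛ FR α) (sym (opposite-involutive i))
                     (FR-cong {state w i} {α} p)

FR-walk-inverse : ∀ k α → Inverse (WalksThrough k α) (WalksThrough k (FR α))
FR-walk-inverse k α = record
  { to        = to
  ; from      = from
  ; to-cong   = λ {x} {y} → FR-walk-cong {k} {proj₁ x} {proj₁ y}
  ; from-cong = λ {x} {y} → FR-walk-cong {k} {proj₁ x} {proj₁ y}
  ; inverse   = (λ {x} {y} → FR-walk-swap {k} {proj₁ y} {proj₁ x})
              , (λ {x} {y} → FR-walk-swap {k} {proj₁ y} {proj₁ x})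
  }
  where
  to : Setoid.Carrier (WalksThrough k α) → Setoid.Carrier (WalksThrough k (FR α))
  to (w , p) = FR-walk w , FR-walk-passesThrough {w = w} {α} p
  from : Setoid.Carrier (WalksThrough k (FR α)) → Setoid.Carrier (WalksThrough k α)
  from (w , p) = FR-walk w ,
    PassesThrough-resp {w = FR-walk w} {FR (FR α)} {α} (FR-involutive α)
                       (FR-walk-passesThrough {w = w} {FR α} p)

theorem7p9 : (k : ℕ) (α : Seq) →
    Bijection (WalksThrough k α) (WalksThrough k (FR α))
theorem7p9 k α = Inverse⇒Bijection (FR-walk-inverse k α)
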